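{- Let $k\in\mathbb{N}$. Then \[ \int_{\mathbb{Z}_p}\prod_{j=1}^{k}(1+jx)\,d\mu_{ -1}(x)=\sum_{n=0}^{k}k!\binom{H_k}{k-n}_{\mathbb{H}}E_n . \]
   Context: $p$ is an odd prime. For a polynomial $f:\mathbb{Z}_p\to\mathbb{C}_p$ the fermionic $p$-adic integral is $\int_{\mathbb{Z}_p} f(x)\,d\mu_{ -1}(x)=\lim_{N\to\infty}\sum_{x=0}^{p^N-1}(-1)^xf(x)$. The harmonic binomial coefficient is $\binom{H_k}{m}_{\mathbb{H}}=\frac{1}{k!}{k+1\brack m+1}$, where ${a\brack b}$ denotes the unsigned Stirling number of the first kind (number of permutations of $a$ elements with exactly $b$ cycles). The Euler numbers $E_n$ are defined by $\frac{2}{e^t+1}=\sum_{n\ge0}E_n\frac{t^n}{n!}$. -}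

module Defs where

open import Data.Nat as ℕ using (ℕ; zero; suc; _≤_; _^_)
open import Data.Nat.Divisibility using (_∣_)
open import Data.Nat.Combinatorics using (_C_)
open import Data.Nat.Base using (_!)
open import Data.Nat.Properties using (_!≢0)
open import Data.Integer as ℤ using (ℤ; +_)
open import Data.Rational using (ℚ; _/_; _+_; _*_; _-_; -_; 0ℚ; 1ℚ; ½)
open import Data.Fin as Fin using (Fin; toℕ)
open import Data.Vec using (Vec; []; _∷_; lookup; last; _∷ʳ_; tabulate)
open import Data.Product using (∃; _×_)
open import Relation.Nullary using (¬_)
open import Relation.Binary.PropositionalEquality using (_≡_)

ℕ→ℚ : ℕ → ℚ
ℕ→ℚ n = + n / 1

ℤ→ℚ : ℤ → ℚ
ℤ→ℚ z = z / 1

sumℚ : ℕ → (ℕ → ℚ) → ℚ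
sumℚ zero    f = 0ℚ
sumℚ (suc n) f = sumℚ n f + f n

prodℚ : ℕ → (ℕ → ℚ) → ℚ
prodℚ zero    f = 1ℚ
prodℚ (suc n) f = prodℚ n f * f n

sumFin : ∀ {n} → (Fin n → ℚ) → ℚ
sumFin {zero}  f = 0ℚ
sumFin {suc n} f = f Fin.zero + sumFin (λ i → f (Fin.suc i))

stirling1 : ℕ → ℕ → ℕ
stirling1 zero    zero    = 1
stirling1 zero    (suc m) = 0
stirling1 (suc n) zero    = 0
stirling1 (suc n) (suc m) = n ℕ.* stirling1 n (suc m) ℕ.+ stirling1 n m

-- harmonic binomial coefficient  binom(H_k, m)_H = (1/k!) [ k+1 , m+1 ]
harmonicBinom : ℕ → ℕ → ℚ
harmonicBinom k m = (+ stirling1 (suc k) (suc m) / (k !)) {{k !≢0}}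

-- Euler numbers from 2/(e^t+1) = Σ E_n t^n/n!.  Comparing coefficients of
-- t^n/n! in (e^t + 1) · Σ E_n t^n/n! = 2 gives
--   E_n + Σ_{i=0}^{n} C(n,i) E_i = 2·[n = 0],
-- i.e. E_0 = 1 and E_n = -(1/2) Σ_{i<n} C(n,i) E_i for n ≥ 1.
-- eulerVec n = (E_0, …, E_n)
eulerVec : (n : ℕ) → Vec ℚ (suc n)
eulerVec zero    = 1ℚ ∷ []
eulerVec (suc n) = v ∷ʳ (- (½ * sumFin (λ (i : Fin (suc n)) → ℕ→ℚ (suc n C toℕ i) * lookup v i)))
  where v = eulerVec n

E : ℕ → ℚ
E n = last (eulerVec n)

-- p-adic closeness: a ≡ b mod p^M in ℤ_(p), i.e. (a - b)·d = p^M·z with p ∤ d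
PAdicClose : (p M : ℕ) → ℚ → ℚ → Set
PAdicClose p M a b = ∃ λ (z : ℤ) → ∃ λ (d : ℕ) → (¬ (p ∣ d)) × ((a - b) * ℕ→ℚ d ≡ ℕ→ℚ (p ^ M) * ℤ→ℚ z)

PAdicLimit : (p : ℕ) → (ℕ → ℚ) → ℚ → Set
PAdicLimit p s L = ∀ (M : ℕ) → ∃ λ (N₀ : ℕ) → ∀ (N : ℕ) → N₀ ≤ N → PAdicClose p M (s N) L

sign : ℕ → ℚ
sign zero    = 1ℚ
sign (suc x) = - sign x

fermionicPartial : (p : ℕ) → (ℕ → ℚ) → ℕ → ℚ
fermionicPartial p f N = sumℚ (p ^ N) (λ x → sign x * f x)

FermionicIntegral : (p : ℕ) → (ℕ → ℚ) → ℚ → Set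
FermionicIntegral p f L = PAdicLimit p (fermionicPartial p f) L

{-# OPTIONS --safe #-}
module Submission where

open import Defs
open import Data.Nat using (ℕ; suc; _∸_)
open import Data.Nat.Base using (_!)
open import Data.Nat.Divisibility using (_∣_)
open import Data.Nat.Primality using (Prime)
open import Data.Rational using (_+_; _*_; 1ℚ)
open import Relation.Nullary using (¬_)

open import Algebra.Bundles using (CommutativeRing; CommutativeMonoid)
open import Data.Fin as Fin using (Fin; toℕ)
open import Data.Integer as ℤ using (ℤ; +_)
import Data.Integer.Properties as ℤ
open import Data.Nat as ℕ using (zero)
open import Data.Nat.Combinatorics using (_C_; k>n⇒nCk≡0; nCn≡1; nCk+nC[k+1]≡[n+1]C[k+1])
open import Data.Nat.Divisibility using (divides; ∣m∣n⇒∣m+n; ∣1⇒≡1)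
open import Data.Nat.Induction using (<-rec)
open import Data.Nat.Primality using (euclidsLemma; prime⇒irreducible; prime[2]; ¬prime[1])
import Data.Nat.Properties as ℕ
open import Data.Product using (∃; _,_; _×_)
open import Data.Rational as ℚ using (ℚ; _/_; -_; _-_; 0ℚ; ½)
import Data.Rational.Properties as ℚ
open import Data.Rational.Unnormalised as ℚᵘ using (mkℚᵘ; *≡*) renaming (_≃_ to _≃ᵘ_)
import Data.Rational.Unnormalised.Properties as ℚᵘ
open import Data.Sum using (_⊎_; inj₁; inj₂)
open import Data.Vec using (Vec; []; _∷_; _∷ʳ_; lookup)
open import Data.Vec.Properties using (last-∷ʳ)
open import Function using (_∘_)
open import Relation.Binary.PropositionalEquality
open import Relation.Nullary using (contradiction; yes; no)
open import Relation.Nullary.Decidable using (dec⇒maybe)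
open import Tactic.RingSolver using (solve-∀)
open import Tactic.RingSolver.Core.AlmostCommutativeRing using (AlmostCommutativeRing; fromCommutativeRing)

open import Algebra.Properties.Semiring.Exp (CommutativeRing.semiring ℚ.+-*-commutativeRing)
  using (_^_; ^-homo-*)
open import Algebra.Properties.CommutativeSemigroup
  (CommutativeMonoid.commutativeSemigroup ℚ.+-0-commutativeMonoid) using (interchange)

-- Both sides are linear in the integrand, and ∏_{j=1}^k (1 + j x) = Σ_n [k+1, k+1-n] x^n,
-- where [k+1, k+1-n] = k! binom(H_k, k-n)_H; so it suffices to integrate integer polynomials
-- termwise and show ∫ x^n dμ_{-1} = E_n. The Euler polynomials E_n(u) = Σ_i C(n,i) E_i u^(n-i)
-- satisfy E_n(u + 1) + E_n(u) = 2 u^n, which telescopes to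
-- 2 Σ_{x<M} (-1)^x x^n = E_n - (-1)^M E_n(M). For odd M this makes
-- 2 (Σ_{x<M} (-1)^x x^n - E_n) = E_n(M) - E_n(0) a multiple of M with a cofactor whose
-- denominator is a power of 2 (because 2^i E_i ∈ ℤ). With M = p^N and p odd, the partial sums
-- of the integral therefore agree with the claimed value modulo p^N.

ℚ-ring : AlmostCommutativeRing _ _
ℚ-ring = fromCommutativeRing ℚ.+-*-commutativeRing (λ x → dec⇒maybe (0ℚ ℚ.≟ x))

2ℚ : ℚ
2ℚ = ℕ→ℚ 2

toℚᵘ-ℤ→ℚ : ∀ z → ℚ.toℚᵘ (ℤ→ℚ z) ≃ᵘ mkℚᵘ z 0
toℚᵘ-ℤ→ℚ z = ℚ.toℚᵘ-fromℚᵘ (mkℚᵘ z 0)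

ℤ→ℚ-+ : ∀ a b → ℤ→ℚ (a ℤ.+ b) ≡ ℤ→ℚ a + ℤ→ℚ b
ℤ→ℚ-+ a b = ℚ.toℚᵘ-injective (begin
  ℚ.toℚᵘ (ℤ→ℚ (a ℤ.+ b))               ≈⟨ toℚᵘ-ℤ→ℚ (a ℤ.+ b) ⟩
  mkℚᵘ (a ℤ.+ b) 0                     ≈⟨ *≡* (cong (ℤ._* + 1) (sym (cong₂ ℤ._+_ a*1≡a b*1≡b))) ⟩
  mkℚᵘ a 0 ℚᵘ.+ mkℚᵘ b 0               ≈⟨ ℚᵘ.+-cong (toℚᵘ-ℤ→ℚ a) (toℚᵘ-ℤ→ℚ b) ⟨
  ℚ.toℚᵘ (ℤ→ℚ a) ℚᵘ.+ ℚ.toℚᵘ (ℤ→ℚ b)   ≈⟨ ℚ.toℚᵘ-homo-+ (ℤ→ℚ a) (ℤ→ℚ b) ⟨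
  ℚ.toℚᵘ (ℤ→ℚ a + ℤ→ℚ b)               ∎)
  where
  open ℚᵘ.≃-Reasoning
  a*1≡a = ℤ.*-identityʳ a
  b*1≡b = ℤ.*-identityʳ b

ℤ→ℚ-* : ∀ a b → ℤ→ℚ (a ℤ.* b) ≡ ℤ→ℚ a * ℤ→ℚ b
ℤ→ℚ-* a b = ℚ.toℚᵘ-injective (begin
  ℚ.toℚᵘ (ℤ→ℚ (a ℤ.* b))               ≈⟨ toℚᵘ-ℤ→ℚ (a ℤ.* b) ⟩
  mkℚᵘ (a ℤ.* b) 0                     ≈⟨ *≡* refl ⟩
  mkℚᵘ a 0 ℚᵘ.* mkℚᵘ b 0               ≈⟨ ℚᵘ.*-cong (toℚᵘ-ℤ→ℚ a) (toℚᵘ-ℤ→ℚ b) ⟨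
  ℚ.toℚᵘ (ℤ→ℚ a) ℚᵘ.* ℚ.toℚᵘ (ℤ→ℚ b)   ≈⟨ ℚ.toℚᵘ-homo-* (ℤ→ℚ a) (ℤ→ℚ b) ⟨
  ℚ.toℚᵘ (ℤ→ℚ a * ℤ→ℚ b)               ∎)
  where open ℚᵘ.≃-Reasoning

ℤ→ℚ-neg : ∀ a → ℤ→ℚ (ℤ.- a) ≡ - ℤ→ℚ a
ℤ→ℚ-neg a = ℚ.toℚᵘ-injective (begin
  ℚ.toℚᵘ (ℤ→ℚ (ℤ.- a))     ≈⟨ toℚᵘ-ℤ→ℚ (ℤ.- a) ⟩
  ℚᵘ.- mkℚᵘ a 0            ≈⟨ ℚᵘ.-‿cong (toℚᵘ-ℤ→ℚ a) ⟨
  ℚᵘ.- ℚ.toℚᵘ (ℤ→ℚ a)      ≈⟨ ℚ.toℚᵘ-homo‿- (ℤ→ℚ a) ⟨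
  ℚ.toℚᵘ (- ℤ→ℚ a)         ∎)
  where open ℚᵘ.≃-Reasoning

ℕ→ℚ-+ : ∀ m n → ℕ→ℚ (m ℕ.+ n) ≡ ℕ→ℚ m + ℕ→ℚ n
ℕ→ℚ-+ m n = trans (cong ℤ→ℚ (ℤ.pos-+ m n)) (ℤ→ℚ-+ (+ m) (+ n))

ℕ→ℚ-* : ∀ m n → ℕ→ℚ (m ℕ.* n) ≡ ℕ→ℚ m * ℕ→ℚ n
ℕ→ℚ-* m n = trans (cong ℤ→ℚ (ℤ.pos-* m n)) (ℤ→ℚ-* (+ m) (+ n))

ℕ→ℚ-^ : ∀ m n → ℕ→ℚ (m ℕ.^ n) ≡ ℕ→ℚ m ^ n
ℕ→ℚ-^ m zero    = refl
ℕ→ℚ-^ m (suc n) = trans (ℕ→ℚ-* m (m ℕ.^ n)) (cong (ℕ→ℚ m *_) (ℕ→ℚ-^ m n))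

ℕ→ℚ-*-/ : ∀ m n .{{_ : ℕ.NonZero n}} → ℕ→ℚ n * (+ m / n) ≡ ℕ→ℚ m
ℕ→ℚ-*-/ m n@(suc n-1) = ℚ.toℚᵘ-injective (begin
  ℚ.toℚᵘ (ℕ→ℚ n * (+ m / n))                  ≈⟨ ℚ.toℚᵘ-homo-* (ℕ→ℚ n) (+ m / n) ⟩
  ℚ.toℚᵘ (ℕ→ℚ n) ℚᵘ.* ℚ.toℚᵘ (+ m / n)   ≈⟨ ℚᵘ.*-cong (toℚᵘ-ℤ→ℚ (+ n)) (ℚ.toℚᵘ-fromℚᵘ (mkℚᵘ (+ m) n-1)) ⟩
  mkℚᵘ (+ n) 0 ℚᵘ.* mkℚᵘ (+ m) n-1       ≈⟨ *≡* cross-multiplied ⟩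
  mkℚᵘ (+ m) 0                           ≈⟨ toℚᵘ-ℤ→ℚ (+ m) ⟨
  ℚ.toℚᵘ (ℕ→ℚ m)                         ∎)
  where
  open ℚᵘ.≃-Reasoning
  cross-multiplied : (+ n ℤ.* + m) ℤ.* + 1 ≡ + m ℤ.* + (1 ℕ.* n)
  cross-multiplied = trans (ℤ.*-identityʳ _)
    (trans (ℤ.*-comm (+ n) (+ m)) (cong (λ d → + m ℤ.* + d) (sym (ℕ.*-identityˡ n))))

open ≡-Reasoning

-- Finite sums

sumℚ-cong : ∀ n {f g} → (∀ i → i ℕ.< n → f i ≡ g i) → sumℚ n f ≡ sumℚ n g
sumℚ-cong zero    f≡g = refl
sumℚ-cong (suc n) f≡g =
  cong₂ _+_ (sumℚ-cong n (λ i i<n → f≡g i (ℕ.m<n⇒m<1+n i<n))) (f≡g n (ℕ.n<1+n n))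

sumℚ-0 : ∀ n → sumℚ n (λ _ → 0ℚ) ≡ 0ℚ
sumℚ-0 zero    = refl
sumℚ-0 (suc n) = cong (_+ 0ℚ) (sumℚ-0 n)

sumℚ-shift : ∀ n f → sumℚ (suc n) f ≡ f 0 + sumℚ n (f ∘ suc)
sumℚ-shift zero    f = ℚ.+-comm 0ℚ (f 0)
sumℚ-shift (suc n) f = begin
  sumℚ (suc n) f + f (suc n)          ≡⟨ cong (_+ f (suc n)) (sumℚ-shift n f) ⟩
  f 0 + sumℚ n (f ∘ suc) + f (suc n)  ≡⟨ ℚ.+-assoc (f 0) _ _ ⟩
  f 0 + sumℚ (suc n) (f ∘ suc)        ∎

sumℚ-+ : ∀ n f g → sumℚ n (λ i → f i + g i) ≡ sumℚ n f + sumℚ n g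
sumℚ-+ zero    f g = refl
sumℚ-+ (suc n) f g =
  trans (cong (_+ (f n + g n)) (sumℚ-+ n f g)) (interchange (sumℚ n f) (sumℚ n g) (f n) (g n))

sumℚ-sub : ∀ n f g → sumℚ n f - sumℚ n g ≡ sumℚ n (λ i → f i - g i)
sumℚ-sub zero    f g = refl
sumℚ-sub (suc n) f g = begin
  (sumℚ n f + f n) - (sumℚ n g + g n)      ≡⟨ regroup (sumℚ n f) (f n) (sumℚ n g) (g n) ⟩
  (sumℚ n f - sumℚ n g) + (f n - g n)      ≡⟨ cong (_+ (f n - g n)) (sumℚ-sub n f g) ⟩
  sumℚ (suc n) (λ i → f i - g i)           ∎
  where
  regroup : ∀ a b c d → (a + b) - (c + d) ≡ (a - c) + (b - d)
  regroup = solve-∀ ℚ-ring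

sumℚ-*ˡ : ∀ n c f → sumℚ n (λ i → c * f i) ≡ c * sumℚ n f
sumℚ-*ˡ zero    c f = sym (ℚ.*-zeroʳ c)
sumℚ-*ˡ (suc n) c f = trans (cong (_+ c * f n) (sumℚ-*ˡ n c f)) (sym (ℚ.*-distribˡ-+ c _ (f n)))

sumℚ-comm : ∀ m n (f : ℕ → ℕ → ℚ) →
            sumℚ m (λ x → sumℚ n (f x)) ≡ sumℚ n (λ y → sumℚ m (λ x → f x y))
sumℚ-comm zero    n f = sym (sumℚ-0 n)
sumℚ-comm (suc m) n f =
  trans (cong (_+ sumℚ n (f m)) (sumℚ-comm m n f)) (sym (sumℚ-+ n (λ y → sumℚ m (λ x → f x y)) (f m)))

sumFin≡sumℚ : ∀ n {g : Fin n → ℚ} {f} → (∀ i → g i ≡ f (toℕ i)) → sumFin g ≡ sumℚ n f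
sumFin≡sumℚ zero            g≡f = refl
sumFin≡sumℚ (suc n) {f = f} g≡f =
  trans (cong₂ _+_ (g≡f Fin.zero) (sumFin≡sumℚ n (g≡f ∘ Fin.suc))) (sym (sumℚ-shift n f))

-- Integrality in ℚ

IsInt : ℚ → Set
IsInt q = ∃ λ z → q ≡ ℤ→ℚ z

isInt-ℕ : ∀ n → IsInt (ℕ→ℚ n)
isInt-ℕ n = + n , refl

isInt-+ : ∀ {a b} → IsInt a → IsInt b → IsInt (a + b)
isInt-+ (x , refl) (y , refl) = x ℤ.+ y , sym (ℤ→ℚ-+ x y)

isInt-* : ∀ {a b} → IsInt a → IsInt b → IsInt (a * b)
isInt-* (x , refl) (y , refl) = x ℤ.* y , sym (ℤ→ℚ-* x y)

isInt-neg : ∀ {a} → IsInt a → IsInt (- a)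
isInt-neg (x , refl) = ℤ.- x , sym (ℤ→ℚ-neg x)

isInt-^ : ∀ {a} n → IsInt a → IsInt (a ^ n)
isInt-^ zero    _  = isInt-ℕ 1
isInt-^ (suc n) ia = isInt-* ia (isInt-^ n ia)

isInt-sumℚ : ∀ n {f} → (∀ i → i ℕ.< n → IsInt (f i)) → IsInt (sumℚ n f)
isInt-sumℚ zero    _   = isInt-ℕ 0
isInt-sumℚ (suc n) int =
  isInt-+ (isInt-sumℚ n (λ i i<n → int i (ℕ.m<n⇒m<1+n i<n))) (int n (ℕ.n<1+n n))

MultipleOf : ℕ → ℚ → Set
MultipleOf m q = ∃ λ z → q ≡ ℕ→ℚ m * ℤ→ℚ z

multipleOf-* : ∀ m {q} → IsInt q → MultipleOf m (ℕ→ℚ m * q)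
multipleOf-* m (z , refl) = z , refl

multipleOf-+ : ∀ {m a b} → MultipleOf m a → MultipleOf m b → MultipleOf m (a + b)
multipleOf-+ {m} (x , refl) (y , refl) =
  x ℤ.+ y , trans (sym (ℚ.*-distribˡ-+ (ℕ→ℚ m) _ _)) (cong (ℕ→ℚ m *_) (sym (ℤ→ℚ-+ x y)))

multipleOf-sumℚ : ∀ {m} n {f} → (∀ i → i ℕ.< n → MultipleOf m (f i)) → MultipleOf m (sumℚ n f)
multipleOf-sumℚ {m} zero    _ = + 0 , sym (ℚ.*-zeroʳ (ℕ→ℚ m))
multipleOf-sumℚ {m} (suc n) mul =
  multipleOf-+ {m} (multipleOf-sumℚ {m} n (λ i i<n → mul i (ℕ.m<n⇒m<1+n i<n))) (mul n (ℕ.n<1+n n))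

multipleOf-*ˡ : ∀ {m a b} → IsInt a → MultipleOf m b → MultipleOf m (a * b)
multipleOf-*ˡ {m} (x , refl) (y , refl) = y ℤ.* x , (begin
  ℤ→ℚ x * (ℕ→ℚ m * ℤ→ℚ y)    ≡⟨ swap (ℤ→ℚ x) (ℕ→ℚ m) (ℤ→ℚ y) ⟩
  ℕ→ℚ m * (ℤ→ℚ y * ℤ→ℚ x)    ≡⟨ cong (ℕ→ℚ m *_) (ℤ→ℚ-* y x) ⟨
  ℕ→ℚ m * ℤ→ℚ (y ℤ.* x)      ∎)
  where
  swap : ∀ a b c → a * (b * c) ≡ b * (c * a)
  swap = solve-∀ ℚ-ring

multipleOf-∣ : ∀ {m n q} → m ∣ n → MultipleOf n q → MultipleOf m q
multipleOf-∣ {m} (divides k refl) (z , refl) = + k ℤ.* z , (begin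
  ℕ→ℚ (k ℕ.* m) * ℤ→ℚ z        ≡⟨ cong (_* ℤ→ℚ z) (ℕ→ℚ-* k m) ⟩
  ℕ→ℚ k * ℕ→ℚ m * ℤ→ℚ z        ≡⟨ swap (ℕ→ℚ k) (ℕ→ℚ m) (ℤ→ℚ z) ⟩
  ℕ→ℚ m * (ℕ→ℚ k * ℤ→ℚ z)      ≡⟨ cong (ℕ→ℚ m *_) (ℤ→ℚ-* (+ k) z) ⟨
  ℕ→ℚ m * ℤ→ℚ (+ k ℤ.* z)      ∎)
  where
  swap : ∀ a b c → a * b * c ≡ b * (a * c)
  swap = solve-∀ ℚ-ring

-- Appell polynomials

-- appell e u n = Σ_{i ≤ n} C(n,i) e_i u^(n-i); the recursion is Pascal's rule.
appell : (ℕ → ℚ) → ℚ → ℕ → ℚ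
appell e u zero    = e 0
appell e u (suc n) = u * appell e u n + appell (e ∘ suc) u n

appell-cong : ∀ n u {e e′} → (∀ i → e i ≡ e′ i) → appell e u n ≡ appell e′ u n
appell-cong zero    u e≡e′ = e≡e′ 0
appell-cong (suc n) u e≡e′ =
  cong₂ (λ a b → u * a + b) (appell-cong n u e≡e′) (appell-cong n u (e≡e′ ∘ suc))

appell-+ : ∀ n u e e′ → appell (λ i → e i + e′ i) u n ≡ appell e u n + appell e′ u n
appell-+ zero    u e e′ = refl
appell-+ (suc n) u e e′ = begin
  u * appell (λ i → e i + e′ i) u n + appell (λ i → e (suc i) + e′ (suc i)) u n
    ≡⟨ cong₂ (λ a b → u * a + b) (appell-+ n u e e′) (appell-+ n u (e ∘ suc) (e′ ∘ suc)) ⟩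
  u * (A + A′) + (B + B′)      ≡⟨ cong (_+ (B + B′)) (ℚ.*-distribˡ-+ u A A′) ⟩
  (u * A + u * A′) + (B + B′)  ≡⟨ interchange (u * A) (u * A′) B B′ ⟩
  (u * A + B) + (u * A′ + B′)  ∎
  where
  A = appell e u n
  A′ = appell e′ u n
  B = appell (e ∘ suc) u n
  B′ = appell (e′ ∘ suc) u n

appell-neg : ∀ n u e → appell (λ i → - e i) u n ≡ - appell e u n
appell-neg zero    u e = refl
appell-neg (suc n) u e =
  trans (cong₂ (λ a b → u * a + b) (appell-neg n u e) (appell-neg n u (e ∘ suc)))
        (negate u (appell e u n) (appell (e ∘ suc) u n))
  where
  negate : ∀ u a b → u * (- a) + (- b) ≡ - (u * a + b)
  negate = solve-∀ ℚ-ring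

appell-0 : ∀ n u → appell (λ _ → 0ℚ) u n ≡ 0ℚ
appell-0 zero    u = refl
appell-0 (suc n) u = trans (cong (λ a → u * a + a) (appell-0 n u)) (annihilate u)
  where
  annihilate : ∀ u → u * 0ℚ + 0ℚ ≡ 0ℚ
  annihilate = solve-∀ ℚ-ring

appell-at-0 : ∀ n e → appell e 0ℚ n ≡ e n
appell-at-0 zero    e = refl
appell-at-0 (suc n) e =
  trans (cong₂ _+_ (ℚ.*-zeroˡ (appell e 0ℚ n)) (appell-at-0 n (e ∘ suc))) (ℚ.+-identityˡ (e (suc n)))

appell-at-1 : ∀ n e → appell e 1ℚ n ≡ sumℚ (suc n) (λ i → ℕ→ℚ (n C i) * e i)
appell-at-1 zero    e = sym (trans (ℚ.+-identityˡ _) (ℚ.*-identityˡ (e 0)))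
appell-at-1 (suc n) e = begin
  1ℚ * appell e 1ℚ n + appell (e ∘ suc) 1ℚ n
    ≡⟨ cong₂ (λ a b → 1ℚ * a + b) (appell-at-1 n e) (appell-at-1 n (e ∘ suc)) ⟩
  1ℚ * sumℚ (suc n) (λ i → B i * e i) + sumℚ (suc n) (λ i → B i * e (suc i))
    ≡⟨ cong (_+ sumℚ (suc n) (λ i → B i * e (suc i))) (ℚ.*-identityˡ (sumℚ (suc n) (λ i → B i * e i))) ⟩
  sumℚ (suc n) (λ i → B i * e i) + sumℚ (suc n) (λ i → B i * e (suc i))
    ≡⟨ cong (_+ sumℚ (suc n) (λ i → B i * e (suc i))) lower ⟩
  (e 0 + sumℚ (suc n) (λ i → B (suc i) * e (suc i))) + sumℚ (suc n) (λ i → B i * e (suc i))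
    ≡⟨ x+y+z≈x+z+y (e 0) _ _ ⟩
  e 0 + (sumℚ (suc n) (λ i → B i * e (suc i)) + sumℚ (suc n) (λ i → B (suc i) * e (suc i)))
    ≡⟨ cong (λ s → e 0 + s) (sym (sumℚ-+ (suc n) _ _)) ⟩
  e 0 + sumℚ (suc n) (λ i → B i * e (suc i) + B (suc i) * e (suc i))
    ≡⟨ cong (λ s → e 0 + s) (sumℚ-cong (suc n) (λ i _ → pascal i)) ⟩
  e 0 + sumℚ (suc n) (λ i → ℕ→ℚ (suc n C suc i) * e (suc i))
    ≡⟨ cong (_+ sumℚ (suc n) (λ i → ℕ→ℚ (suc n C suc i) * e (suc i))) (ℚ.*-identityˡ (e 0)) ⟨
  1ℚ * e 0 + sumℚ (suc n) (λ i → ℕ→ℚ (suc n C suc i) * e (suc i))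
    ≡⟨ sumℚ-shift (suc n) (λ i → ℕ→ℚ (suc n C i) * e i) ⟨
  sumℚ (suc (suc n)) (λ i → ℕ→ℚ (suc n C i) * e i)  ∎
  where
  B : ℕ → ℚ
  B i = ℕ→ℚ (n C i)

  x+y+z≈x+z+y : ∀ x y z → (x + y) + z ≡ x + (z + y)
  x+y+z≈x+z+y = solve-∀ ℚ-ring

  lower : sumℚ (suc n) (λ i → B i * e i) ≡ e 0 + sumℚ (suc n) (λ i → B (suc i) * e (suc i))
  lower = begin
    sumℚ (suc n) (λ i → B i * e i)                   ≡⟨ sumℚ-shift n (λ i → B i * e i) ⟩
    1ℚ * e 0 + S                                     ≡⟨ cong₂ _+_ (ℚ.*-identityˡ (e 0)) (sym S+top≡S) ⟩
    e 0 + sumℚ (suc n) (λ i → B (suc i) * e (suc i)) ∎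
    where
    S = sumℚ n (λ i → B (suc i) * e (suc i))

    top-vanishes : B (suc n) * e (suc n) ≡ 0ℚ
    top-vanishes = trans (cong (λ b → ℕ→ℚ b * e (suc n)) (k>n⇒nCk≡0 (ℕ.n<1+n n))) (ℚ.*-zeroˡ (e (suc n)))

    S+top≡S : S + B (suc n) * e (suc n) ≡ S
    S+top≡S = trans (cong (λ t → S + t) top-vanishes) (ℚ.+-identityʳ S)

  pascal : ∀ i → B i * e (suc i) + B (suc i) * e (suc i) ≡ ℕ→ℚ (suc n C suc i) * e (suc i)
  pascal i = begin
    B i * e (suc i) + B (suc i) * e (suc i)  ≡⟨ ℚ.*-distribʳ-+ (e (suc i)) (B i) (B (suc i)) ⟨
    (B i + B (suc i)) * e (suc i)            ≡⟨ cong (_* e (suc i)) (ℕ→ℚ-+ (n C i) (n C suc i)) ⟨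
    ℕ→ℚ (n C i ℕ.+ n C suc i) * e (suc i)
      ≡⟨ cong (λ b → ℕ→ℚ b * e (suc i)) (nCk+nC[k+1]≡[n+1]C[k+1] n i) ⟩
    ℕ→ℚ (suc n C suc i) * e (suc i)          ∎

appell-shift : ∀ n e u → appell e (1ℚ + u) n ≡ appell (appell e 1ℚ) u n
appell-shift zero    e u = refl
appell-shift (suc n) e u = begin
  (1ℚ + u) * appell e (1ℚ + u) n + appell (e ∘ suc) (1ℚ + u) n
    ≡⟨ cong₂ (λ a b → (1ℚ + u) * a + b) (appell-shift n e u) (appell-shift n (e ∘ suc) u) ⟩
  (1ℚ + u) * R + R′
    ≡⟨ regroup u R R′ ⟩
  u * R + (R + R′)
    ≡⟨ cong (λ s → u * R + s) (appell-+ n u (appell e 1ℚ) (appell (e ∘ suc) 1ℚ)) ⟨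
  u * R + appell (λ m → appell e 1ℚ m + appell (e ∘ suc) 1ℚ m) u n
    ≡⟨ cong (λ s → u * R + s) (appell-cong n u unfold) ⟨
  u * R + appell (appell e 1ℚ ∘ suc) u n  ∎
  where
  R = appell (appell e 1ℚ) u n
  R′ = appell (appell (e ∘ suc) 1ℚ) u n

  unfold : ∀ m → appell e 1ℚ (suc m) ≡ appell e 1ℚ m + appell (e ∘ suc) 1ℚ m
  unfold m = cong (_+ appell (e ∘ suc) 1ℚ m) (ℚ.*-identityˡ (appell e 1ℚ m))

  regroup : ∀ u a b → (1ℚ + u) * a + b ≡ u * a + (a + b)
  regroup = solve-∀ ℚ-ring

appellSlope : (ℕ → ℚ) → ℚ → ℕ → ℚ
appellSlope e u zero    = 0ℚ
appellSlope e u (suc n) = appell e u n + appellSlope (e ∘ suc) u n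

appell-sub-head : ∀ n e u → appell e u n - e n ≡ u * appellSlope e u n
appell-sub-head zero    e u = trans (ℚ.+-inverseʳ (e 0)) (sym (ℚ.*-zeroʳ u))
appell-sub-head (suc n) e u = begin
  (u * A + B) - e (suc n)        ≡⟨ ℚ.+-assoc (u * A) B (- e (suc n)) ⟩
  u * A + (B - e (suc n))        ≡⟨ cong (λ s → u * A + s) (appell-sub-head n (e ∘ suc) u) ⟩
  u * A + u * appellSlope (e ∘ suc) u n  ≡⟨ ℚ.*-distribˡ-+ u A _ ⟨
  u * appellSlope e u (suc n)    ∎
  where
  A = appell e u n
  B = appell (e ∘ suc) u n

2^-split : ∀ {i m} → i ℕ.≤ m → 2ℚ ^ m ≡ 2ℚ ^ (m ∸ i) * 2ℚ ^ i
2^-split {i} {m} i≤m = trans (cong (2ℚ ^_) (sym (ℕ.m∸n+n≡m i≤m))) (^-homo-* 2ℚ (m ∸ i) i)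

TwoPowerIntegral : ℕ → (ℕ → ℚ) → Set
TwoPowerIntegral c e = ∀ i → IsInt (2ℚ ^ (c ℕ.+ i) * e i)

twoPowerIntegral-shift : ∀ {c e} → TwoPowerIntegral c e → TwoPowerIntegral (suc c) (e ∘ suc)
twoPowerIntegral-shift {c} {e} int i =
  subst (λ k → IsInt (2ℚ ^ k * e (suc i))) (ℕ.+-suc c i) (int (suc i))

appell-twoPowerIntegral : ∀ n {c e u} → TwoPowerIntegral c e → IsInt u →
                          IsInt (2ℚ ^ (c ℕ.+ n) * appell e u n)
appell-twoPowerIntegral zero          int _     = int 0
appell-twoPowerIntegral (suc n) {c} {e} {u} int u-int =
  subst (λ k → IsInt (2ℚ ^ k * appell e u (suc n))) (sym (ℕ.+-suc c n))
    (subst IsInt (sym (expand 2ℚ (2ℚ ^ (c ℕ.+ n)) u (appell e u n) (appell (e ∘ suc) u n)))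
      (isInt-+ (isInt-* (isInt-* (isInt-ℕ 2) u-int) (appell-twoPowerIntegral n {c} {e} int u-int))
               (appell-twoPowerIntegral n {suc c} {e ∘ suc} (twoPowerIntegral-shift {c} {e} int) u-int)))
  where
  expand : ∀ t P u a b → t * P * (u * a + b) ≡ t * u * (P * a) + t * P * b
  expand = solve-∀ ℚ-ring

appellSlope-twoPowerIntegral : ∀ n {c e u} → TwoPowerIntegral c e → IsInt u →
                               IsInt (2ℚ ^ (c ℕ.+ n) * appellSlope e u n)
appellSlope-twoPowerIntegral zero    {c} _ _ = subst IsInt (sym (ℚ.*-zeroʳ (2ℚ ^ (c ℕ.+ 0)))) (isInt-ℕ 0)
appellSlope-twoPowerIntegral (suc n) {c} {e} {u} int u-int =
  subst (λ k → IsInt (2ℚ ^ k * appellSlope e u (suc n))) (sym (ℕ.+-suc c n))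
    (subst IsInt (sym (expand 2ℚ (2ℚ ^ (c ℕ.+ n)) (appell e u n) (appellSlope (e ∘ suc) u n)))
      (isInt-+ (isInt-* (isInt-ℕ 2) (appell-twoPowerIntegral n {c} {e} int u-int))
               (appellSlope-twoPowerIntegral n {suc c} {e ∘ suc} (twoPowerIntegral-shift {c} {e} int) u-int)))
  where
  expand : ∀ t P a b → t * P * (a + b) ≡ t * (P * a) + t * P * b
  expand = solve-∀ ℚ-ring

-- Euler numbers and Euler polynomials

lookup-∷ʳ : ∀ {A : Set} {n} (xs : Vec A n) {x} {f : ℕ → A} →
            (∀ i → lookup xs i ≡ f (toℕ i)) → x ≡ f n → ∀ i → lookup (xs ∷ʳ x) i ≡ f (toℕ i)
lookup-∷ʳ []       _   x≡ Fin.zero     = x≡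
lookup-∷ʳ []       _   _  (Fin.suc ())
lookup-∷ʳ (y ∷ xs) xs≡ _  Fin.zero     = xs≡ Fin.zero
lookup-∷ʳ (y ∷ xs) {f = f} xs≡ x≡ (Fin.suc i) = lookup-∷ʳ xs {f = f ∘ suc} (xs≡ ∘ Fin.suc) x≡ i

lookup-eulerVec : ∀ n i → lookup (eulerVec n) i ≡ E (toℕ i)
lookup-eulerVec zero    Fin.zero = refl
lookup-eulerVec (suc n) = lookup-∷ʳ (eulerVec n) {f = E} (lookup-eulerVec n) (sym (last-∷ʳ _ (eulerVec n)))

E-suc : ∀ m → E (suc m) ≡ - (½ * sumℚ (suc m) (λ i → ℕ→ℚ (suc m C i) * E i))
E-suc m = trans (last-∷ʳ _ (eulerVec m)) (cong (λ s → - (½ * s))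
  (sumFin≡sumℚ (suc m) (λ i → cong (ℕ→ℚ (suc m C toℕ i) *_) (lookup-eulerVec m i))))

E-twoPowerIntegral : TwoPowerIntegral 0 E
E-twoPowerIntegral = <-rec (λ n → IsInt (2ℚ ^ n * E n)) step
  where
  step : ∀ n → (∀ {i} → i ℕ.< n → IsInt (2ℚ ^ i * E i)) → IsInt (2ℚ ^ n * E n)
  step zero    _  = isInt-ℕ 1
  step (suc m) ih = subst IsInt (sym twoPower-E) (isInt-neg (isInt-sumℚ (suc m) term))
    where
    X = sumℚ (suc m) (λ i → ℕ→ℚ (suc m C i) * E i)

    twoPower-E : 2ℚ ^ suc m * E (suc m) ≡ - sumℚ (suc m) (λ i → 2ℚ ^ m * (ℕ→ℚ (suc m C i) * E i))
    twoPower-E = begin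
      2ℚ * 2ℚ ^ m * E (suc m)         ≡⟨ cong (2ℚ * 2ℚ ^ m *_) (E-suc m) ⟩
      2ℚ * 2ℚ ^ m * - (½ * X)         ≡⟨ halve (2ℚ ^ m) X ⟩
      - (2ℚ ^ m * X)                  ≡⟨ cong -_ (sumℚ-*ˡ (suc m) (2ℚ ^ m) _) ⟨
      - sumℚ (suc m) (λ i → 2ℚ ^ m * (ℕ→ℚ (suc m C i) * E i))  ∎
      where
      halve : ∀ P X → 2ℚ * P * - (½ * X) ≡ - (P * X)
      halve = solve-∀ ℚ-ring

    term : ∀ i → i ℕ.< suc m → IsInt (2ℚ ^ m * (ℕ→ℚ (suc m C i) * E i))
    term i (ℕ.s≤s i≤m) = subst IsInt (sym (begin
      2ℚ ^ m * (b * E i)                       ≡⟨ cong (_* (b * E i)) (2^-split i≤m) ⟩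
      2ℚ ^ (m ∸ i) * 2ℚ ^ i * (b * E i)        ≡⟨ regroup (2ℚ ^ (m ∸ i)) (2ℚ ^ i) b (E i) ⟩
      b * 2ℚ ^ (m ∸ i) * (2ℚ ^ i * E i)        ∎))
      (isInt-* (isInt-* (isInt-ℕ (suc m C i)) (isInt-^ (m ∸ i) (isInt-ℕ 2))) (ih (ℕ.s≤s i≤m)))
      where
      b = ℕ→ℚ (suc m C i)
      regroup : ∀ a b c e → a * b * (c * e) ≡ c * a * (b * e)
      regroup = solve-∀ ℚ-ring

const2 : ℕ → ℚ
const2 zero    = 2ℚ
const2 (suc _) = 0ℚ

appell-const2 : ∀ n u → appell const2 u n ≡ 2ℚ * u ^ n
appell-const2 zero    u = refl
appell-const2 (suc n) u =
  trans (cong₂ (λ a b → u * a + b) (appell-const2 n u) (appell-0 n u)) (rotate u (u ^ n))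
  where
  rotate : ∀ u p → u * (2ℚ * p) + 0ℚ ≡ 2ℚ * (u * p)
  rotate = solve-∀ ℚ-ring

appell-E-at-1 : ∀ n → appell E 1ℚ n ≡ const2 n - E n
appell-E-at-1 zero    = refl
appell-E-at-1 (suc m) = begin
  appell E 1ℚ (suc m)                        ≡⟨ appell-at-1 (suc m) E ⟩
  X + ℕ→ℚ (suc m C suc m) * E (suc m)        ≡⟨ cong (λ b → X + ℕ→ℚ b * E (suc m)) (nCn≡1 (suc m)) ⟩
  X + 1ℚ * E (suc m)                         ≡⟨ cong (λ e → X + 1ℚ * e) (E-suc m) ⟩
  X + 1ℚ * - (½ * X)                         ≡⟨ cancel X ⟩
  0ℚ - - (½ * X)                             ≡⟨ cong (λ e → 0ℚ - e) (E-suc m) ⟨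
  0ℚ - E (suc m)                             ∎
  where
  X = sumℚ (suc m) (λ i → ℕ→ℚ (suc m C i) * E i)
  cancel : ∀ x → x + 1ℚ * - (½ * x) ≡ 0ℚ - - (½ * x)
  cancel = solve-∀ ℚ-ring

eulerPoly : ℚ → ℕ → ℚ
eulerPoly = appell E

eulerPoly-1+ : ∀ n u → eulerPoly (1ℚ + u) n ≡ 2ℚ * u ^ n - eulerPoly u n
eulerPoly-1+ n u = begin
  appell E (1ℚ + u) n                             ≡⟨ appell-shift n E u ⟩
  appell (appell E 1ℚ) u n                        ≡⟨ appell-cong n u appell-E-at-1 ⟩
  appell (λ m → const2 m - E m) u n               ≡⟨ appell-+ n u const2 (λ m → - E m) ⟩
  appell const2 u n + appell (λ m → - E m) u n    ≡⟨ cong₂ _+_ (appell-const2 n u) (appell-neg n u E) ⟩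
  2ℚ * u ^ n - appell E u n                       ∎

alternatingPowerSum : ℕ → ℕ → ℚ
alternatingPowerSum M n = sumℚ M (λ x → sign x * ℕ→ℚ x ^ n)

alternatingPowerSum-eulerPoly : ∀ M n →
  2ℚ * alternatingPowerSum M n ≡ E n - sign M * eulerPoly (ℕ→ℚ M) n
alternatingPowerSum-eulerPoly zero    n =
  trans (cancel (E n)) (cong (λ e → E n - 1ℚ * e) (sym (appell-at-0 n E)))
  where
  cancel : ∀ e → 2ℚ * 0ℚ ≡ e - 1ℚ * e
  cancel = solve-∀ ℚ-ring
alternatingPowerSum-eulerPoly (suc M) n = begin
  2ℚ * (S + s * p)                     ≡⟨ ℚ.*-distribˡ-+ 2ℚ S (s * p) ⟩
  2ℚ * S + 2ℚ * (s * p)                ≡⟨ cong (_+ 2ℚ * (s * p)) (alternatingPowerSum-eulerPoly M n) ⟩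
  (E n - s * A) + 2ℚ * (s * p)         ≡⟨ regroup (E n) s A p ⟩
  E n - (- s) * (2ℚ * p - A)           ≡⟨ cong (λ a → E n - (- s) * a) (eulerPoly-1+ n (ℕ→ℚ M)) ⟨
  E n - (- s) * eulerPoly (1ℚ + ℕ→ℚ M) n  ≡⟨ cong (λ u → E n - (- s) * eulerPoly u n) (ℕ→ℚ-+ 1 M) ⟨
  E n - (- s) * eulerPoly (ℕ→ℚ (suc M)) n ∎
  where
  S = alternatingPowerSum M n
  s = sign M
  p = ℕ→ℚ M ^ n
  A = eulerPoly (ℕ→ℚ M) n
  regroup : ∀ e s a p → (e - s * a) + 2ℚ * (s * p) ≡ e - (- s) * (2ℚ * p - a)
  regroup = solve-∀ ℚ-ring

sign-parity : ∀ M → (2 ∣ M × sign M ≡ 1ℚ) ⊎ (2 ∣ suc M × sign M ≡ - 1ℚ)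
sign-parity zero    = inj₁ (divides 0 refl , refl)
sign-parity (suc M) with sign-parity M
... | inj₁ (2∣M , s≡1)    = inj₂ (∣m∣n⇒∣m+n (divides 1 refl) 2∣M , cong -_ s≡1)
... | inj₂ (2∣1+M , s≡-1) = inj₁ (2∣1+M , cong -_ s≡-1)

sign-odd : ∀ {M} → ¬ 2 ∣ M → sign M ≡ - 1ℚ
sign-odd {M} 2∤M with sign-parity M
... | inj₁ (2∣M , _) = contradiction 2∣M 2∤M
... | inj₂ (_ , s≡-1) = s≡-1

alternatingPowerSum-odd : ∀ {M} → ¬ 2 ∣ M → ∀ n →
  MultipleOf M (2ℚ ^ suc n * (alternatingPowerSum M n - E n))
alternatingPowerSum-odd {M} 2∤M n =
  subst (MultipleOf M) (sym eq)
    (multipleOf-* M (appellSlope-twoPowerIntegral n {0} {E} E-twoPowerIntegral (isInt-ℕ M)))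
  where
  S = alternatingPowerSum M n
  A = eulerPoly (ℕ→ℚ M) n
  P = 2ℚ ^ n
  eq : 2ℚ * P * (S - E n) ≡ ℕ→ℚ M * (P * appellSlope E (ℕ→ℚ M) n)
  eq = begin
    2ℚ * P * (S - E n)                ≡⟨ distrib 2ℚ P S (E n) ⟩
    P * (2ℚ * S - 2ℚ * E n)           ≡⟨ cong (λ t → P * (t - 2ℚ * E n)) (alternatingPowerSum-eulerPoly M n) ⟩
    P * ((E n - sign M * A) - 2ℚ * E n) ≡⟨ cong (λ s → P * ((E n - s * A) - 2ℚ * E n)) (sign-odd 2∤M) ⟩
    P * ((E n - - 1ℚ * A) - 2ℚ * E n) ≡⟨ cong (P *_) (simplify (E n) A) ⟩
    P * (A - E n)                     ≡⟨ cong (P *_) (appell-sub-head n E (ℕ→ℚ M)) ⟩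
    P * (ℕ→ℚ M * appellSlope E (ℕ→ℚ M) n) ≡⟨ swap P (ℕ→ℚ M) _ ⟩
    ℕ→ℚ M * (P * appellSlope E (ℕ→ℚ M) n) ∎
    where
    distrib : ∀ t P S e → t * P * (S - e) ≡ P * (t * S - t * e)
    distrib = solve-∀ ℚ-ring
    simplify : ∀ e a → (e - - 1ℚ * a) - 2ℚ * e ≡ a - e
    simplify = solve-∀ ℚ-ring
    swap : ∀ a b c → a * (b * c) ≡ b * (a * c)
    swap = solve-∀ ℚ-ring

-- Fermionic integrals of integer polynomials

evalPoly : ℕ → (ℕ → ℚ) → ℚ → ℚ
evalPoly d c x = sumℚ d (λ n → c n * x ^ n)

alternatingSum-evalPoly : ∀ M d c →
  sumℚ M (λ x → sign x * evalPoly d c (ℕ→ℚ x)) ≡ sumℚ d (λ n → c n * alternatingPowerSum M n)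
alternatingSum-evalPoly M d c = begin
  sumℚ M (λ x → sign x * sumℚ d (λ n → c n * ℕ→ℚ x ^ n))
    ≡⟨ sumℚ-cong M (λ x _ → sumℚ-*ˡ d (sign x) _) ⟨
  sumℚ M (λ x → sumℚ d (λ n → sign x * (c n * ℕ→ℚ x ^ n)))
    ≡⟨ sumℚ-comm M d _ ⟩
  sumℚ d (λ n → sumℚ M (λ x → sign x * (c n * ℕ→ℚ x ^ n)))
    ≡⟨ sumℚ-cong d (λ n _ → sumℚ-cong M (λ x _ → swap (sign x) (c n) _)) ⟩
  sumℚ d (λ n → sumℚ M (λ x → c n * (sign x * ℕ→ℚ x ^ n)))
    ≡⟨ sumℚ-cong d (λ n _ → sumℚ-*ˡ M (c n) _) ⟩
  sumℚ d (λ n → c n * alternatingPowerSum M n)  ∎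
  where
  swap : ∀ a b c → a * (b * c) ≡ b * (a * c)
  swap = solve-∀ ℚ-ring

evalPoly-alternatingSum-odd : ∀ {M} → ¬ 2 ∣ M → ∀ d (c : ℕ → ℚ) → (∀ n → n ℕ.< d → IsInt (c n)) →
  MultipleOf M (2ℚ ^ d * (sumℚ d (λ n → c n * alternatingPowerSum M n)
                          - sumℚ d (λ n → c n * E n)))
evalPoly-alternatingSum-odd {M} 2∤M d c c-int =
  subst (MultipleOf M) (sym distribute) (multipleOf-sumℚ {M} d term)
  where
  S = alternatingPowerSum M

  distribute : 2ℚ ^ d * (sumℚ d (λ n → c n * S n) - sumℚ d (λ n → c n * E n))
             ≡ sumℚ d (λ n → 2ℚ ^ d * (c n * S n - c n * E n))
  distribute = begin
    2ℚ ^ d * (sumℚ d (λ n → c n * S n) - sumℚ d (λ n → c n * E n))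
      ≡⟨ cong (2ℚ ^ d *_) (sumℚ-sub d (λ n → c n * S n) (λ n → c n * E n)) ⟩
    2ℚ ^ d * sumℚ d (λ n → c n * S n - c n * E n)
      ≡⟨ sumℚ-*ˡ d (2ℚ ^ d) (λ n → c n * S n - c n * E n) ⟨
    sumℚ d (λ n → 2ℚ ^ d * (c n * S n - c n * E n)) ∎

  term : ∀ n → n ℕ.< d → MultipleOf M (2ℚ ^ d * (c n * S n - c n * E n))
  term n n<d = subst (MultipleOf M) (sym (begin
    2ℚ ^ d * (c n * S n - c n * E n)                ≡⟨ cong (_* (c n * S n - c n * E n)) (2^-split n<d) ⟩
    2ℚ ^ (d ∸ suc n) * 2ℚ ^ suc n * (c n * S n - c n * E n)
      ≡⟨ regroup (2ℚ ^ (d ∸ suc n)) (2ℚ ^ suc n) (c n) (S n) (E n) ⟩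
    c n * 2ℚ ^ (d ∸ suc n) * (2ℚ ^ suc n * (S n - E n)) ∎))
    (multipleOf-*ˡ {M} (isInt-* (c-int n n<d) (isInt-^ (d ∸ suc n) (isInt-ℕ 2)))
                       (alternatingPowerSum-odd 2∤M n))
    where
    regroup : ∀ q p c s e → q * p * (c * s - c * e) ≡ c * q * (p * (s - e))
    regroup = solve-∀ ℚ-ring

prime∣^⇒∣ : ∀ {q m} n → Prime q → q ∣ m ℕ.^ n → q ∣ m
prime∣^⇒∣ zero q-prime q∣1 = contradiction (∣1⇒≡1 q∣1) λ { refl → ¬prime[1] q-prime }
prime∣^⇒∣ {m = m} (suc n) q-prime q∣m^1+n with euclidsLemma m (m ℕ.^ n) q-prime q∣m^1+n
... | inj₁ q∣m   = q∣m
... | inj₂ q∣m^n = prime∣^⇒∣ n q-prime q∣m^n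

odd-prime∤2^ : ∀ {p} → Prime p → ¬ 2 ∣ p → ∀ k → ¬ p ∣ 2 ℕ.^ k
odd-prime∤2^ p-prime 2∤p k p∣2^k with prime⇒irreducible prime[2] (prime∣^⇒∣ k p-prime p∣2^k)
... | inj₁ refl = ¬prime[1] p-prime
... | inj₂ refl = 2∤p (divides 1 refl)

^-monoʳ-∣ : ∀ m {n o} → n ℕ.≤ o → m ℕ.^ n ∣ m ℕ.^ o
^-monoʳ-∣ m {n} {o} n≤o = divides (m ℕ.^ (o ∸ n)) (begin
  m ℕ.^ o                      ≡⟨ cong (m ℕ.^_) (ℕ.m+[n∸m]≡n n≤o) ⟨
  m ℕ.^ (n ℕ.+ (o ∸ n))        ≡⟨ ℕ.^-distribˡ-+-* m n (o ∸ n) ⟩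
  m ℕ.^ n ℕ.* m ℕ.^ (o ∸ n)    ≡⟨ ℕ.*-comm (m ℕ.^ n) _ ⟩
  m ℕ.^ (o ∸ n) ℕ.* m ℕ.^ n    ∎)

pAdicClose-multipleOf : ∀ {p M a b} D → ¬ p ∣ D → MultipleOf (p ℕ.^ M) (ℕ→ℚ D * (a - b)) → PAdicClose p M a b
pAdicClose-multipleOf {a = a} {b} D p∤D (z , eq) = z , D , p∤D , trans (ℚ.*-comm (a - b) (ℕ→ℚ D)) eq

fermionicIntegral-cong : ∀ {p f g L L′} → (∀ x → f x ≡ g x) → L ≡ L′ →
                         FermionicIntegral p f L → FermionicIntegral p g L′
fermionicIntegral-cong {p} f≡g refl lim M with lim M
... | N₀ , close = N₀ , λ N N₀≤N →
  subst (λ s → PAdicClose p M s _) (sumℚ-cong (p ℕ.^ N) (λ x _ → cong (sign x *_) (f≡g x))) (close N N₀≤N)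

fermionicIntegral-evalPoly : ∀ {p} → Prime p → ¬ 2 ∣ p → ∀ d c → (∀ n → n ℕ.< d → IsInt (c n)) →
  FermionicIntegral p (evalPoly d c ∘ ℕ→ℚ) (sumℚ d (λ n → c n * E n))
fermionicIntegral-evalPoly {p} p-prime 2∤p d c c-int M = M , close
  where
  L = sumℚ d (λ n → c n * E n)

  close : ∀ N → M ℕ.≤ N → PAdicClose p M (fermionicPartial p (evalPoly d c ∘ ℕ→ℚ) N) L
  close N M≤N = pAdicClose-multipleOf {p} {M} {fermionicPartial p (evalPoly d c ∘ ℕ→ℚ) N} {L}
    (2 ℕ.^ d) (odd-prime∤2^ p-prime 2∤p d)
    (multipleOf-∣ {p ℕ.^ M} (^-monoʳ-∣ p M≤N)
      (subst (MultipleOf (p ℕ.^ N))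
        (cong₂ (λ t s → t * (s - L)) (sym (ℕ→ℚ-^ 2 d)) (sym (alternatingSum-evalPoly (p ℕ.^ N) d c)))
        (evalPoly-alternatingSum-odd (λ 2∣p^N → 2∤p (prime∣^⇒∣ N prime[2] 2∣p^N)) d c c-int)))

-- Stirling expansion of ∏ (1 + j x)

mul-1+aX : ℚ → (ℕ → ℚ) → ℕ → ℚ
mul-1+aX a c zero    = c 0
mul-1+aX a c (suc n) = c (suc n) + a * c n

evalPoly-mul-1+aX : ∀ d a c x →
  evalPoly (suc d) (mul-1+aX a c) x ≡ evalPoly d c x * (1ℚ + a * x) + c d * x ^ d
evalPoly-mul-1+aX zero    a c x = absorb (1ℚ + a * x) (c 0 * 1ℚ)
  where
  absorb : ∀ t y → 0ℚ + y ≡ 0ℚ * t + y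
  absorb = solve-∀ ℚ-ring
evalPoly-mul-1+aX (suc d) a c x = begin
  evalPoly (suc d) (mul-1+aX a c) x + (c (suc d) + a * c d) * x ^ suc d
    ≡⟨ cong (_+ (c (suc d) + a * c d) * x ^ suc d) (evalPoly-mul-1+aX d a c x) ⟩
  (evalPoly d c x * (1ℚ + a * x) + c d * x ^ d) + (c (suc d) + a * c d) * (x * x ^ d)
    ≡⟨ regroup (evalPoly d c x) a x (x ^ d) (c d) (c (suc d)) ⟩
  (evalPoly d c x + c d * x ^ d) * (1ℚ + a * x) + c (suc d) * (x * x ^ d)  ∎
  where
  regroup : ∀ P a x y c c′ → (P * (1ℚ + a * x) + c * y) + (c′ + a * c) * (x * y)
                             ≡ (P + c * y) * (1ℚ + a * x) + c′ * (x * y)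
  regroup = solve-∀ ℚ-ring

stirling1-< : ∀ {n m} → n ℕ.< m → stirling1 n m ≡ 0
stirling1-< {zero}  {suc m} _           = refl
stirling1-< {suc n} {suc m} (ℕ.s≤s n<m)
  rewrite stirling1-< (ℕ.m<n⇒m<1+n n<m) | stirling1-< n<m | ℕ.*-zeroʳ n = refl

stirling1-diag : ∀ n → stirling1 n n ≡ 1
stirling1-diag zero    = refl
stirling1-diag (suc n) rewrite stirling1-< (ℕ.n<1+n n) | ℕ.*-zeroʳ n = stirling1-diag n

stirlingCoeff : ℕ → ℕ → ℕ
stirlingCoeff k n = stirling1 (suc k) (suc k ∸ n)

stirlingCoeff-suc : ∀ k n → stirlingCoeff (suc k) (suc n) ≡ stirlingCoeff k (suc n) ℕ.+ suc k ℕ.* stirlingCoeff k n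
stirlingCoeff-suc k n with n ℕ.≤? k
... | yes n≤k rewrite ℕ.+-∸-assoc 1 n≤k = ℕ.+-comm (suc k ℕ.* stirling1 (suc k) (suc (k ∸ n))) _
... | no  n≰k with k<n ← ℕ.≰⇒> n≰k
  rewrite ℕ.m≤n⇒m∸n≡0 k<n | ℕ.m≤n⇒m∸n≡0 (ℕ.<⇒≤ k<n) | ℕ.*-zeroʳ k = refl

mul-1+aX-stirlingCoeff : ∀ k n →
  mul-1+aX (ℕ→ℚ (suc k)) (ℕ→ℚ ∘ stirlingCoeff k) n ≡ ℕ→ℚ (stirlingCoeff (suc k) n)
mul-1+aX-stirlingCoeff k zero    = cong ℕ→ℚ (trans (stirling1-diag (suc k)) (sym (stirling1-diag (suc (suc k)))))
mul-1+aX-stirlingCoeff k (suc n) = sym (begin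
  ℕ→ℚ (stirlingCoeff (suc k) (suc n))                          ≡⟨ cong ℕ→ℚ (stirlingCoeff-suc k n) ⟩
  ℕ→ℚ (stirlingCoeff k (suc n) ℕ.+ suc k ℕ.* stirlingCoeff k n) ≡⟨ ℕ→ℚ-+ (stirlingCoeff k (suc n)) _ ⟩
  ℕ→ℚ (stirlingCoeff k (suc n)) + ℕ→ℚ (suc k ℕ.* stirlingCoeff k n)
    ≡⟨ cong (λ t → ℕ→ℚ (stirlingCoeff k (suc n)) + t) (ℕ→ℚ-* (suc k) (stirlingCoeff k n)) ⟩
  ℕ→ℚ (stirlingCoeff k (suc n)) + ℕ→ℚ (suc k) * ℕ→ℚ (stirlingCoeff k n) ∎)

prod-1+jx-expansion : ∀ k x →
  prodℚ k (λ i → 1ℚ + ℕ→ℚ (suc i) * x) ≡ evalPoly (suc k) (ℕ→ℚ ∘ stirlingCoeff k) x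
prod-1+jx-expansion zero    x = refl
prod-1+jx-expansion (suc k) x = begin
  prodℚ k (λ i → 1ℚ + ℕ→ℚ (suc i) * x) * (1ℚ + a * x)
    ≡⟨ cong (_* (1ℚ + a * x)) (prod-1+jx-expansion k x) ⟩
  evalPoly (suc k) c x * (1ℚ + a * x)
    ≡⟨ ℚ.+-identityʳ _ ⟨
  evalPoly (suc k) c x * (1ℚ + a * x) + 0ℚ
    ≡⟨ cong (λ t → evalPoly (suc k) c x * (1ℚ + a * x) + t) top-vanishes ⟨
  evalPoly (suc k) c x * (1ℚ + a * x) + c (suc k) * x ^ suc k
    ≡⟨ evalPoly-mul-1+aX (suc k) a c x ⟨
  evalPoly (suc (suc k)) (mul-1+aX a c) x
    ≡⟨ sumℚ-cong (suc (suc k)) (λ n _ → cong (_* x ^ n) (mul-1+aX-stirlingCoeff k n)) ⟩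
  evalPoly (suc (suc k)) (ℕ→ℚ ∘ stirlingCoeff (suc k)) x  ∎
  where
  a = ℕ→ℚ (suc k)
  c = ℕ→ℚ ∘ stirlingCoeff k

  top-vanishes : c (suc k) * x ^ suc k ≡ 0ℚ
  top-vanishes = trans (cong (λ m → ℕ→ℚ (stirling1 (suc k) m) * x ^ suc k) (ℕ.n∸n≡0 k)) (ℚ.*-zeroˡ (x ^ suc k))

factorial*harmonicBinom : ∀ k m → ℕ→ℚ (k !) * harmonicBinom k m ≡ ℕ→ℚ (stirling1 (suc k) (suc m))
factorial*harmonicBinom k m = ℕ→ℚ-*-/ (stirling1 (suc k) (suc m)) (k !) {{k ℕ.!≢0}}

harmonicBinomSum≡stirlingSum : ∀ k →
  sumℚ (suc k) (λ n → ℕ→ℚ (k !) * harmonicBinom k (k ∸ n) * E n)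
    ≡ sumℚ (suc k) (λ n → ℕ→ℚ (stirlingCoeff k n) * E n)
harmonicBinomSum≡stirlingSum k = sumℚ-cong (suc k) λ n n<1+k → cong (_* E n) (begin
  ℕ→ℚ (k !) * harmonicBinom k (k ∸ n)       ≡⟨ factorial*harmonicBinom k (k ∸ n) ⟩
  ℕ→ℚ (stirling1 (suc k) (suc (k ∸ n)))    ≡⟨ cong (ℕ→ℚ ∘ stirling1 (suc k)) (ℕ.+-∸-assoc 1 (ℕ.≤-pred n<1+k)) ⟨
  ℕ→ℚ (stirlingCoeff k n)                  ∎)

mainTheorem19 : (p : ℕ) → Prime p → ¬ (2 ∣ p) → (k : ℕ) →
    FermionicIntegral p
      (λ x → prodℚ k (λ i → 1ℚ + ℕ→ℚ (suc i) * ℕ→ℚ x))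
      (sumℚ (suc k) (λ n → ℕ→ℚ (k !) * harmonicBinom k (k ∸ n) * E n))
mainTheorem19 p p-prime 2∤p k =
  fermionicIntegral-cong (λ x → sym (prod-1+jx-expansion k (ℕ→ℚ x))) (sym (harmonicBinomSum≡stirlingSum k))
    (fermionicIntegral-evalPoly p-prime 2∤p (suc k) (ℕ→ℚ ∘ stirlingCoeff k) (λ n _ → isInt-ℕ (stirlingCoeff k n)))
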